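{- For every $n\geq 0$ and every $P\in\mathcal{D}_n^{h,\geq}$, $$\#DDU(P)=\#DF(\phi(P))+\#DU(\phi(P))+\#FUU(\phi(P))+\#FUF(\phi(P)).$$
   Context: A Motzkin path of length $n$ is a word in the steps $U=(1,1)$, $D=(1,-1)$, $F=(1,0)$ forming a lattice path from $(0,0)$ to $(n,0)$ never going below the $x$-axis; $\mathcal{M}_n$ is the set of them. A Dyck path of semilength $n$ is a Motzkin path of length $2n$ without $F$ steps. Every nonempty Dyck path has a unique first return decomposition $P=U\alpha D\beta$ with $\alpha,\beta$ Dyck paths; $h$ denotes maximal height. $\mathcal{D}^{h,\geq}$ is defined recursively: it contains the empty path $\epsilon$, and $P=U\alpha D\beta$ belongs to it iff $\alpha,\beta\in\mathcal{D}^{h,\geq}$ and $h(U\alpha D)\geq h(\beta)$; $\mathcal{D}_n^{h,\geq}$ is the subset of semilength $n$. The bijection $\phi:\mathcal{D}_n^{h,\geq}\to\mathcal{M}_n$ is defined by $\phi(\epsilon)=\epsilon$, $\phi(\alpha UD)=\phi(\alpha)F$, $\phi(\alpha UU\beta D\gamma D)=\phi(\alpha)\phi(\gamma)U\phi(\beta)D$. For a word $X$, $\#X(P)$ is the number of occurrences of $X$ as consecutive steps in $P$. -}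

module Defs where

open import Data.Nat using (ℕ; zero; suc; _+_; _*_; _∸_; _⊔_; _≥_)
open import Data.List using (List; []; _∷_; _++_; length; reverse)
open import Data.List.Relation.Unary.All using (All)
open import Data.Product using (_×_; _,_)
open import Data.Maybe using (Maybe; just; nothing)
open import Data.Bool using (Bool; true; false; _∧_)
open import Relation.Binary.PropositionalEquality using (_≡_; _≢_)

-- Steps U = (1,1), D = (1,-1), F = (1,0); a path is the word of its steps.
data Step : Set where
  U D F : Step

Word : Set
Word = List Step

-- Walk k w : starting at height k, w never goes below the x-axis and ends at height 0.
data Walk : ℕ → Word → Set where
  end  : Walk 0 []
  up   : ∀ {k w} → Walk (suc k) w → Walk k (U ∷ w)
  down : ∀ {k w} → Walk k w → Walk (suc k) (D ∷ w)
  flat : ∀ {k w} → Walk k w → Walk k (F ∷ w)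

IsMotzkin : Word → Set
IsMotzkin w = Walk 0 w

IsDyck : Word → Set
IsDyck w = IsMotzkin w × All (λ s → s ≢ F) w

heightFrom : ℕ → Word → ℕ
heightFrom c []      = c
heightFrom c (U ∷ w) = c ⊔ heightFrom (suc c) w
heightFrom c (D ∷ w) = c ⊔ heightFrom (c ∸ 1) w
heightFrom c (F ∷ w) = c ⊔ heightFrom c w

h : Word → ℕ
h = heightFrom 0

-- D^{h,≥}: defined along the first return decomposition P = U α D β.
-- (Any word built this way is a Dyck path with α, β Dyck paths, so the
--  decomposition used is the first return decomposition.)
data HGe : Word → Set where
  hε   : HGe []
  hcons : ∀ {α β} → HGe α → HGe β → h (U ∷ α ++ D ∷ []) ≥ h β →
          HGe (U ∷ α ++ D ∷ β)

InDhGe : ℕ → Word → Set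
InDhGe n P = IsDyck P × HGe P × length P ≡ 2 * n

-- Given the reversed tail of a word, scanning after a D: find the matching U.
-- matchRev d r : r is read right-to-left; returns (reversed inner part, reversed rest).
matchRev : ℕ → Word → Maybe (Word × Word)
matchRev d       []      = nothing
matchRev zero    (U ∷ r) = just ([] , r)
matchRev (suc d) (U ∷ r) with matchRev d r
... | just (i , r') = just (U ∷ i , r')
... | nothing       = nothing
matchRev d       (D ∷ r) with matchRev (suc d) r
... | just (i , r') = just (D ∷ i , r')
... | nothing       = nothing
matchRev d       (F ∷ r) with matchRev d r
... | just (i , r') = just (F ∷ i , r')
... | nothing       = nothing

-- Last-factor decomposition P = α U Q D, returns (α , Q).
lastSplit : Word → Maybe (Word × Word)
lastSplit P with reverse P
... | D ∷ r with matchRev 0 r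
...   | just (i , r') = just (reverse r' , reverse i)
...   | nothing       = nothing
lastSplit P | _ = nothing

-- Splitting at the matching D: given w read left to right after a U,
-- returns (inner, rest) with w = inner D rest.
matchFwd : ℕ → Word → Maybe (Word × Word)
matchFwd d       []      = nothing
matchFwd zero    (D ∷ w) = just ([] , w)
matchFwd (suc d) (D ∷ w) with matchFwd d w
... | just (i , w') = just (D ∷ i , w')
... | nothing       = nothing
matchFwd d       (U ∷ w) with matchFwd (suc d) w
... | just (i , w') = just (U ∷ i , w')
... | nothing       = nothing
matchFwd d       (F ∷ w) with matchFwd d w
... | just (i , w') = just (F ∷ i , w')
... | nothing       = nothing

-- φ with fuel:  φ(ε) = ε,  φ(α U D) = φ(α) F,
-- φ(α U U β D γ D) = φ(α) φ(γ) U φ(β) D.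
-- (Each recursive call is on a strictly shorter word, so fuel = length suffices.)
φ-fuel : ℕ → Word → Word
φ-fuel zero    P = []
φ-fuel (suc k) P with lastSplit P
... | nothing = []
... | just (α , []) = φ-fuel k α ++ F ∷ []
... | just (α , U ∷ Q') with matchFwd 0 Q'
...   | just (β , γ) = φ-fuel k α ++ φ-fuel k γ ++ U ∷ φ-fuel k β ++ D ∷ []
...   | nothing      = []
φ-fuel (suc k) P | just (α , _ ∷ _) = []

φ : Word → Word
φ P = φ-fuel (length P) P

_==ˢ_ : Step → Step → Bool
U ==ˢ U = true
D ==ˢ D = true
F ==ˢ F = true
_ ==ˢ _ = false

isPrefix : Word → Word → Bool
isPrefix []      _       = true
isPrefix (_ ∷ _) []      = false
isPrefix (x ∷ X) (y ∷ w) = (x ==ˢ y) ∧ isPrefix X w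

occ : Word → Word → ℕ
occ X []        with isPrefix X []
... | true  = 1
... | false = 0
occ X (s ∷ w) with isPrefix X (s ∷ w)
... | true  = suc (occ X w)
... | false = occ X w

-- Induction along the first return decomposition P = U α D β, with α = ε or α = U β′ D γ′.
-- A DDU of P lies inside α, inside β, or consists of the last D of α, the D closing U α D
-- and the first U of β; so #DDU(P) = #DDU(α) + #DDU(β) + [α ≠ ε][β ≠ ε].  On the other
-- side φ(P) = φ(U α D) φ(β), with φ(U D) = F and φ(U α D) = φ(γ′) U φ(β′) D.  The image of
-- a nonempty Dyck path begins with U or F and ends with F or D, so the four patterns are
-- additive across these seams up to one occurrence (DU, DF, FUU or FUF) at each of the
-- seams D·φ(β) and φ(γ′)·U φ(β′) whose two sides are nonempty, matching the DDU terms.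
-- When α = ε or β′ = ε, the height condition gives β resp. γ′ height at most 1, so its
-- image is a run of F steps and the seam F·φ(β) resp. φ(γ′)·U D creates no pattern.

module Submission where

open import Defs
open import Data.Nat using (ℕ; _+_)
open import Data.List using (List; []; _∷_)
open import Relation.Binary.PropositionalEquality using (_≡_)

open import Data.Nat using (zero; suc; s≤s; _*_; _≤_; _<_; _≥_; _≤′_; ≤′-refl; ≤′-step)
open import Data.Nat.Properties
  using ( ≤-refl; ≤-trans; ≤-pred; <⇒≤; ≤⇒≤′; ≤′⇒≤; m+n≤o⇒m≤o; m+n≤o⇒n≤o
        ; +-monoʳ-<; +-monoʳ-≤; m≤m+n; n≤1+n; m≤m⊔n; m≤n⊔m; +-comm; +-assoc; +-identityʳ)
open import Data.Nat.Tactic.RingSolver using (solve-∀)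
open import Data.Bool using (Bool; true; false; _∧_)
open import Data.Bool.Properties using (∧-zeroʳ)
open import Data.List using (_++_; length; reverse; _ʳ++_)
open import Data.List.Properties
  using ( ++-assoc; ++-identityʳ; ++-ʳ++; reverse-involutive
        ; length-++; length-++-≤ˡ; length-++-≤ʳ)
open import Data.List.Relation.Unary.All using (All; []; _∷_)
open import Data.Product using (_×_; _,_; ∃-syntax; ∃₂)
open import Data.Maybe using (just)
open import Data.Empty using (⊥-elim)
open import Relation.Binary.PropositionalEquality
open ≡-Reasoning

data Dyck : Word → Set where
  ε      : Dyck []
  return : ∀ {α β} → Dyck α → Dyck β → Dyck (U ∷ α ++ D ∷ β)

HGe⇒Dyck : ∀ {w} → HGe w → Dyck w
HGe⇒Dyck hε             = ε
HGe⇒Dyck (hcons hα hβ _) = return (HGe⇒Dyck hα) (HGe⇒Dyck hβ)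

data LastReturn : Word → Set where
  ε   : LastReturn []
  _▷_ : ∀ {x q} → Dyck x → Dyck q → LastReturn (x ++ U ∷ q ++ D ∷ [])

lastReturn : ∀ {w} → Dyck w → LastReturn w
lastReturn ε = ε
lastReturn (return dα dβ) with lastReturn dβ
... | ε       = ε ▷ dα
... | _▷_ {x} {q} dx dq =
  subst LastReturn (cong (U ∷_) (++-assoc _ (D ∷ x) (U ∷ q ++ D ∷ []))) (return dα dx ▷ dq)

matchFwd-D : ∀ {d w i w'} → matchFwd d w ≡ just (i , w') →
             matchFwd (suc d) (D ∷ w) ≡ just (D ∷ i , w')
matchFwd-D e rewrite e = refl

matchFwd-U : ∀ {d w i w'} → matchFwd (suc d) w ≡ just (i , w') →
             matchFwd d (U ∷ w) ≡ just (U ∷ i , w')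
matchFwd-U {zero}  e rewrite e = refl
matchFwd-U {suc d} e rewrite e = refl

matchFwd-Dyck : ∀ {β} → Dyck β → ∀ {d w i w'} → matchFwd d w ≡ just (i , w') →
                matchFwd d (β ++ w) ≡ just (β ++ i , w')
matchFwd-Dyck ε e = e
matchFwd-Dyck (return {α} {β} dα dβ) {d} {w} {i} e
  rewrite ++-assoc α (D ∷ β) w | ++-assoc α (D ∷ β) i =
  matchFwd-U {d} (matchFwd-Dyck dα {suc d} {D ∷ β ++ w}
                   (matchFwd-D {d} {β ++ w} (matchFwd-Dyck dβ {d} {w} e)))

matchFwd-return : ∀ {β} → Dyck β → ∀ γ → matchFwd 0 (β ++ D ∷ γ) ≡ just (β , γ)
matchFwd-return {β} dβ γ =
  subst (λ i → matchFwd 0 (β ++ D ∷ γ) ≡ just (i , γ)) (++-identityʳ β)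
        (matchFwd-Dyck dβ {0} {D ∷ γ} refl)

matchRev-D : ∀ {d r i r'} → matchRev (suc d) r ≡ just (i , r') →
             matchRev d (D ∷ r) ≡ just (D ∷ i , r')
matchRev-D {zero}  e rewrite e = refl
matchRev-D {suc d} e rewrite e = refl

matchRev-U : ∀ {d r i r'} → matchRev d r ≡ just (i , r') →
             matchRev (suc d) (U ∷ r) ≡ just (U ∷ i , r')
matchRev-U e rewrite e = refl

matchRev-Dyck : ∀ {q} → Dyck q → ∀ {d r i r'} → matchRev d r ≡ just (i , r') →
                matchRev d (q ʳ++ r) ≡ just (q ʳ++ i , r')
matchRev-Dyck ε e = e
matchRev-Dyck (return {α} {β} dα dβ) {d} {r} {i} e
  rewrite ++-ʳ++ α {D ∷ β} {U ∷ r} | ++-ʳ++ α {D ∷ β} {U ∷ i} =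
  matchRev-Dyck dβ (matchRev-D {d} (matchRev-Dyck dα {suc d} {U ∷ r} (matchRev-U {d} {r} e)))

reverse-lastReturn : ∀ x q → reverse (x ++ U ∷ q ++ D ∷ []) ≡ D ∷ q ʳ++ (U ∷ reverse x)
reverse-lastReturn x q
  rewrite ++-ʳ++ x {U ∷ q ++ D ∷ []} {[]} | ++-ʳ++ q {D ∷ []} {U ∷ reverse x} = refl

lastSplit-lastReturn : ∀ x {q} → Dyck q → lastSplit (x ++ U ∷ q ++ D ∷ []) ≡ just (x , q)
lastSplit-lastReturn x {q} dq
  rewrite reverse-lastReturn x q | matchRev-Dyck dq {0} {U ∷ reverse x} {[]} {reverse x} refl
        | reverse-involutive x | reverse-involutive q = refl

φ-fuel-[] : ∀ k → φ-fuel k [] ≡ []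
φ-fuel-[] zero    = refl
φ-fuel-[] (suc k) = refl

-- The image of the last factor U q D under one unfolding of φ-fuel (its last two clauses).
φ-fuel-lastFactor : ℕ → ∀ {q} → Dyck q → Word
φ-fuel-lastFactor k ε                      = F ∷ []
φ-fuel-lastFactor k (return {β} {γ} _ _) = φ-fuel k γ ++ U ∷ φ-fuel k β ++ D ∷ []

φ-fuel-lastReturn : ∀ k x {q} (dq : Dyck q) →
                    φ-fuel (suc k) (x ++ U ∷ q ++ D ∷ []) ≡ φ-fuel k x ++ φ-fuel-lastFactor k dq
φ-fuel-lastReturn k x ε rewrite lastSplit-lastReturn x ε = refl
φ-fuel-lastReturn k x (return {β} {γ} dβ dγ)
  rewrite lastSplit-lastReturn x (return dβ dγ) | matchFwd-return dβ γ = refl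

lastReturn-shorter : ∀ x q → length x + length q < length (x ++ U ∷ q ++ D ∷ [])
lastReturn-shorter x q rewrite length-++ x {U ∷ q ++ D ∷ []} | length-++ q {D ∷ []} =
  +-monoʳ-< (length x) (s≤s (m≤m+n (length q) 1))

return-shorter : ∀ β γ → length β + length γ < length (U ∷ β ++ D ∷ γ)
return-shorter β γ rewrite length-++ β {D ∷ γ} = s≤s (+-monoʳ-≤ (length β) (n≤1+n (length γ)))

φ-fuel-suc : ∀ k {w} → Dyck w → length w ≤ k → φ-fuel (suc k) w ≡ φ-fuel k w
φ-fuel-suc zero    ε  _  = refl
φ-fuel-suc (suc k) dw le with lastReturn dw
... | ε = refl
... | _▷_ {x} {q} dx dq = begin
  φ-fuel (suc (suc k)) (x ++ U ∷ q ++ D ∷ [])    ≡⟨ φ-fuel-lastReturn (suc k) x dq ⟩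
  φ-fuel (suc k) x ++ φ-fuel-lastFactor (suc k) dq
    ≡⟨ cong₂ _++_ (φ-fuel-suc k dx (m+n≤o⇒m≤o _ bound))
                  (lastFactor-suc dq (m+n≤o⇒n≤o _ bound)) ⟩
  φ-fuel k x ++ φ-fuel-lastFactor k dq             ≡⟨ φ-fuel-lastReturn k x dq ⟨
  φ-fuel (suc k) (x ++ U ∷ q ++ D ∷ [])          ∎
  where
  bound : length x + length q ≤ k
  bound = ≤-pred (≤-trans (lastReturn-shorter x q) le)
  lastFactor-suc : ∀ {q} (dq : Dyck q) → length q ≤ k →
                   φ-fuel-lastFactor (suc k) dq ≡ φ-fuel-lastFactor k dq
  lastFactor-suc ε _ = refl
  lastFactor-suc (return {β} {γ} dβ dγ) le′ =
    cong₂ (λ b g → g ++ U ∷ b ++ D ∷ [])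
          (φ-fuel-suc k dβ (m+n≤o⇒m≤o _ bound′)) (φ-fuel-suc k dγ (m+n≤o⇒n≤o _ bound′))
    where
    bound′ : length β + length γ ≤ k
    bound′ = <⇒≤ (≤-trans (return-shorter β γ) le′)

φ-fuel-stable : ∀ {k w} → Dyck w → length w ≤ k → φ-fuel k w ≡ φ w
φ-fuel-stable {w = w} dw le = stable (≤⇒≤′ le)
  where
  stable : ∀ {k} → length w ≤′ k → φ-fuel k w ≡ φ w
  stable ≤′-refl         = refl
  stable (≤′-step le′) = trans (φ-fuel-suc _ dw (≤′⇒≤ le′)) (stable le′)

φ-fuel-++ : ∀ k {x y} → Dyck x → Dyck y → length (x ++ y) ≤ k →
            φ-fuel k (x ++ y) ≡ φ-fuel k x ++ φ-fuel k y
φ-fuel-++ zero    dx dy le = refl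
φ-fuel-++ (suc k) {x} dx dy le with lastReturn dy
... | ε = begin
  φ-fuel (suc k) (x ++ [])      ≡⟨ cong (φ-fuel (suc k)) (++-identityʳ x) ⟩
  φ-fuel (suc k) x              ≡⟨ ++-identityʳ _ ⟨
  φ-fuel (suc k) x ++ []        ∎
... | _▷_ {y} {q} dy′ dq = begin
  φ-fuel (suc k) (x ++ y ++ U ∷ q ++ D ∷ [])        ≡⟨ cong (φ-fuel (suc k)) (++-assoc x y _) ⟨
  φ-fuel (suc k) ((x ++ y) ++ U ∷ q ++ D ∷ [])      ≡⟨ φ-fuel-lastReturn k (x ++ y) dq ⟩
  φ-fuel k (x ++ y) ++ φ-fuel-lastFactor k dq        ≡⟨ cong (_++ _) (φ-fuel-++ k dx dy′ bound) ⟩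
  (φ-fuel k x ++ φ-fuel k y) ++ φ-fuel-lastFactor k dq ≡⟨ ++-assoc (φ-fuel k x) _ _ ⟩
  φ-fuel k x ++ φ-fuel k y ++ φ-fuel-lastFactor k dq
    ≡⟨ cong₂ _++_ (φ-fuel-suc k dx (≤-trans (length-++-≤ˡ x) bound)) (φ-fuel-lastReturn k y dq) ⟨
  φ-fuel (suc k) x ++ φ-fuel (suc k) (y ++ U ∷ q ++ D ∷ []) ∎
  where
  bound : length (x ++ y) ≤ k
  bound = m+n≤o⇒m≤o _ (≤-pred (≤-trans (lastReturn-shorter (x ++ y) q)
            (subst (λ w → length w ≤ suc k) (sym (++-assoc x y _)) le)))

φ-++ : ∀ {x y} → Dyck x → Dyck y → φ (x ++ y) ≡ φ x ++ φ y
φ-++ {x} {y} dx dy = trans (φ-fuel-++ _ dx dy ≤-refl)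
  (cong₂ _++_ (φ-fuel-stable dx (length-++-≤ˡ x)) (φ-fuel-stable dy (length-++-≤ʳ y {x})))

φ-return : ∀ {α β} → Dyck α → Dyck β →
           φ (U ∷ α ++ D ∷ β) ≡ φ (U ∷ α ++ D ∷ []) ++ φ β
φ-return {α} {β} dα dβ = subst (λ w → φ (U ∷ w) ≡ φ (U ∷ α ++ D ∷ []) ++ φ β)
                               (++-assoc α (D ∷ []) β) (φ-++ (return dα ε) dβ)

φ-nest : ∀ {β γ} → Dyck β → Dyck γ →
         φ (U ∷ (U ∷ β ++ D ∷ γ) ++ D ∷ []) ≡ φ γ ++ U ∷ φ β ++ D ∷ []
φ-nest {β} {γ} dβ dγ = begin
  φ-fuel (suc n) (U ∷ q ++ D ∷ [])
    ≡⟨ φ-fuel-lastReturn n [] (return dβ dγ) ⟩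
  φ-fuel n [] ++ φ-fuel n γ ++ U ∷ φ-fuel n β ++ D ∷ []
    ≡⟨ cong (_++ φ-fuel n γ ++ U ∷ φ-fuel n β ++ D ∷ []) (φ-fuel-[] n) ⟩
  φ-fuel n γ ++ U ∷ φ-fuel n β ++ D ∷ []
    ≡⟨ cong₂ (λ b g → g ++ U ∷ b ++ D ∷ []) (φ-fuel-stable dβ (m+n≤o⇒m≤o _ bound))
                                            (φ-fuel-stable dγ (m+n≤o⇒n≤o _ bound)) ⟩
  φ γ ++ U ∷ φ β ++ D ∷ []                                  ∎
  where
  q : Word
  q = U ∷ β ++ D ∷ γ
  n : ℕ
  n = length (q ++ D ∷ [])
  bound : length β + length γ ≤ n
  bound = <⇒≤ (≤-trans (return-shorter β γ) (length-++-≤ˡ q))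

StartsNotD : Word → Set
StartsNotD w = ∃₂ λ s t → s ≢ D × w ≡ s ∷ t

EndsNotU : Word → Set
EndsNotU w = ∃₂ λ x e → e ≢ U × w ≡ x ++ e ∷ []

StartsNotD-++ : ∀ {x} y → StartsNotD x → StartsNotD (x ++ y)
StartsNotD-++ y (s , t , s≢D , refl) = s , t ++ y , s≢D , refl

EndsNotU-++ : ∀ x {y} → EndsNotU y → EndsNotU (x ++ y)
EndsNotU-++ x (z , e , e≢U , refl) = x ++ z , e , e≢U , sym (++-assoc x z (e ∷ []))

φ-return-startsNotD : ∀ {α β} → Dyck α → Dyck β → StartsNotD (φ (U ∷ α ++ D ∷ β))
φ-return-startsNotD {α} {β} dα dβ rewrite φ-return dα dβ = StartsNotD-++ (φ β) (prime dα)
  where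
  prime : ∀ {α} → Dyck α → StartsNotD (φ (U ∷ α ++ D ∷ []))
  prime ε = F , [] , (λ ()) , refl
  prime (return dβ′ ε) rewrite φ-nest dβ′ ε = U , _ , (λ ()) , refl
  prime (return dβ′ (return dγ₁ dγ₂)) rewrite φ-nest dβ′ (return dγ₁ dγ₂) =
    StartsNotD-++ _ (φ-return-startsNotD dγ₁ dγ₂)

φ-return-endsNotU : ∀ {α β} → Dyck α → Dyck β → EndsNotU (φ (U ∷ α ++ D ∷ β))
φ-return-endsNotU ε ε = [] , F , (λ ()) , refl
φ-return-endsNotU (return {β} {γ} dβ dγ) ε rewrite φ-nest dβ dγ =
  φ γ ++ U ∷ φ β , D , (λ ()) , sym (++-assoc (φ γ) (U ∷ φ β) (D ∷ []))
φ-return-endsNotU {α} dα (return dβ₁ dβ₂) rewrite φ-return dα (return dβ₁ dβ₂) =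
  EndsNotU-++ (φ (U ∷ α ++ D ∷ [])) (φ-return-endsNotU dβ₁ dβ₂)

heightFrom-≥ : ∀ c w → c ≤ heightFrom c w
heightFrom-≥ c []      = ≤-refl
heightFrom-≥ c (U ∷ w) = m≤m⊔n c _
heightFrom-≥ c (D ∷ w) = m≤m⊔n c _
heightFrom-≥ c (F ∷ w) = m≤m⊔n c _

h-UU : ∀ w → 2 ≤ h (U ∷ U ∷ w)
h-UU w = ≤-trans (heightFrom-≥ 2 w) (m≤n⊔m 1 _)

φ-flat : ∀ {w} → HGe w → h w ≤ 1 → All (_≡ F) (φ w)
φ-flat hε _ = []
φ-flat (hcons {[]} hε hβ hβ≤1) _ rewrite φ-return ε (HGe⇒Dyck hβ) = refl ∷ φ-flat hβ hβ≤1
φ-flat (hcons {_} {β} (hcons {a} {b} _ _ _) _ _) h≤1 with ≤-trans (h-UU ((a ++ D ∷ b) ++ D ∷ β)) h≤1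
... | s≤s ()

==ˢ-≢ : ∀ a b → a ≢ b → (a ==ˢ b) ≡ false
==ˢ-≢ U U a≢b = ⊥-elim (a≢b refl)
==ˢ-≢ D D a≢b = ⊥-elim (a≢b refl)
==ˢ-≢ F F a≢b = ⊥-elim (a≢b refl)
==ˢ-≢ U D _   = refl
==ˢ-≢ U F _   = refl
==ˢ-≢ D U _   = refl
==ˢ-≢ D F _   = refl
==ˢ-≢ F U _   = refl
==ˢ-≢ F D _   = refl

isPrefix-∷ʳ-[] : ∀ X b → isPrefix (X ++ b ∷ []) [] ≡ false
isPrefix-∷ʳ-[] []      b = refl
isPrefix-∷ʳ-[] (_ ∷ _) b = refl

isPrefix-∷ʳ : ∀ X b {s} → b ≢ s → ∀ w →
              isPrefix (X ++ b ∷ []) (w ++ s ∷ []) ≡ isPrefix (X ++ b ∷ []) w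
isPrefix-∷ʳ []      b {s} b≢s []      rewrite ==ˢ-≢ b s b≢s = refl
isPrefix-∷ʳ []      b     _   (_ ∷ _) = refl
isPrefix-∷ʳ (a ∷ X) b {s} _   []      = trans (cong ((a ==ˢ s) ∧_) (isPrefix-∷ʳ-[] X b)) (∧-zeroʳ _)
isPrefix-∷ʳ (a ∷ X) b     b≢s (t ∷ w) = cong ((a ==ˢ t) ∧_) (isPrefix-∷ʳ X b b≢s w)

-- An occurrence of X ++ [b] cannot run past a letter e that does not occur in X.
isPrefix-cut : ∀ X b {e} → All (_≢ e) X → ∀ v y →
               isPrefix (X ++ b ∷ []) ((v ++ e ∷ []) ++ y) ≡ isPrefix (X ++ b ∷ []) (v ++ e ∷ [])
isPrefix-cut []      b _           []      y = refl
isPrefix-cut []      b _           (_ ∷ _) y = refl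
isPrefix-cut (a ∷ X) b {e} (a≢e ∷ _) []    y rewrite ==ˢ-≢ a e a≢e = refl
isPrefix-cut (a ∷ X) b (_ ∷ X≢e)   (t ∷ v) y = cong ((a ==ˢ t) ∧_) (isPrefix-cut X b X≢e v y)

toℕ : Bool → ℕ
toℕ false = 0
toℕ true  = 1

occ-∷ : ∀ X s w → occ X (s ∷ w) ≡ toℕ (isPrefix X (s ∷ w)) + occ X w
occ-∷ X s w with isPrefix X (s ∷ w)
... | true  = refl
... | false = refl

occ-∷ʳ : ∀ X b {s} → b ≢ s → ∀ w → occ (X ++ b ∷ []) (w ++ s ∷ []) ≡ occ (X ++ b ∷ []) w
occ-∷ʳ X b {s} b≢s [] =
  trans (occ-∷ (X ++ b ∷ []) s [])
        (cong (λ p → toℕ p + occ (X ++ b ∷ []) [])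
              (trans (isPrefix-∷ʳ X b b≢s []) (isPrefix-∷ʳ-[] X b)))
occ-∷ʳ X b {s} b≢s (t ∷ w) = begin
  occ P (t ∷ w ++ s ∷ [])                      ≡⟨ occ-∷ P t (w ++ s ∷ []) ⟩
  toℕ (isPrefix P (t ∷ w ++ s ∷ [])) + occ P (w ++ s ∷ [])
    ≡⟨ cong₂ (λ p n → toℕ p + n) (isPrefix-∷ʳ X b b≢s (t ∷ w)) (occ-∷ʳ X b b≢s w) ⟩
  toℕ (isPrefix P (t ∷ w)) + occ P w           ≡⟨ occ-∷ P t w ⟨
  occ P (t ∷ w)                                ∎
  where
  P : Word
  P = X ++ b ∷ []

-- No occurrence of X that starts before z reaches into y.
Confines : Word → Word → Word → Set
Confines X z y = ∀ s v → isPrefix X (s ∷ (v ++ z) ++ y) ≡ isPrefix X (s ∷ v ++ z)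

-- Occurrences inside z are counted on both sides, hence the hypothesis occ X z ≡ 0.
occ-++-overlap : ∀ X {z y} → Confines X z y → occ X z ≡ 0 →
                 ∀ x → occ X ((x ++ z) ++ y) ≡ occ X (x ++ z) + occ X (z ++ y)
occ-++-overlap X {z} {y} _ z₀ [] = cong (_+ occ X (z ++ y)) (sym z₀)
occ-++-overlap X {z} {y} confines z₀ (s ∷ x) = begin
  occ X (s ∷ (x ++ z) ++ y)                                   ≡⟨ occ-∷ X s ((x ++ z) ++ y) ⟩
  toℕ (isPrefix X (s ∷ (x ++ z) ++ y)) + occ X ((x ++ z) ++ y)
    ≡⟨ cong₂ (λ p n → toℕ p + n) (confines s x) (occ-++-overlap X confines z₀ x) ⟩
  toℕ (isPrefix X (s ∷ x ++ z)) + (occ X (x ++ z) + occ X (z ++ y))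
    ≡⟨ +-assoc (toℕ (isPrefix X (s ∷ x ++ z))) _ _ ⟨
  toℕ (isPrefix X (s ∷ x ++ z)) + occ X (x ++ z) + occ X (z ++ y)
    ≡⟨ cong (_+ occ X (z ++ y)) (occ-∷ X s (x ++ z)) ⟨
  occ X (s ∷ x ++ z) + occ X (z ++ y)                         ∎

occ-cut : ∀ a X b {e} → All (_≢ e) X → ∀ x y →
          occ (a ∷ X ++ b ∷ []) ((x ++ e ∷ []) ++ y)
          ≡ occ (a ∷ X ++ b ∷ []) (x ++ e ∷ []) + occ (a ∷ X ++ b ∷ []) (e ∷ y)
occ-cut a X b {e} X≢e x y =
  occ-++-overlap (a ∷ X ++ b ∷ []) (λ s v → cong ((a ==ˢ s) ∧_) (isPrefix-cut X b X≢e v y)) single x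
  where
  single : occ (a ∷ X ++ b ∷ []) (e ∷ []) ≡ 0
  single = trans (occ-∷ (a ∷ X ++ b ∷ []) e [])
                 (cong (λ p → toℕ p + 0)
                       (trans (cong ((a ==ˢ e) ∧_) (isPrefix-∷ʳ-[] X b)) (∧-zeroʳ _)))

#DDU : Word → ℕ
#DDU = occ (D ∷ D ∷ U ∷ [])

[nonEmpty] : Word → ℕ
[nonEmpty] []      = 0
[nonEmpty] (_ ∷ _) = 1

return-∷ʳD : ∀ {a b} → Dyck b → ∃[ x ] U ∷ a ++ D ∷ b ≡ x ++ D ∷ []
return-∷ʳD {a} ε = U ∷ a , refl
return-∷ʳD {a} (return _ dc) with return-∷ʳD dc
... | x , eq = U ∷ a ++ D ∷ x ,
  trans (cong (λ w → U ∷ a ++ D ∷ w) eq) (cong (U ∷_) (sym (++-assoc a (D ∷ x) (D ∷ []))))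

#DDU-∷ʳD-D : ∀ x y → #DDU ((x ++ D ∷ []) ++ D ∷ y) ≡ #DDU (x ++ D ∷ []) + #DDU (D ∷ D ∷ y)
#DDU-∷ʳD-D x y = occ-++-overlap (D ∷ D ∷ U ∷ []) confines refl x
  where
  confines : Confines (D ∷ D ∷ U ∷ []) (D ∷ []) (D ∷ y)
  confines _ []          = refl
  confines _ (_ ∷ [])    = refl
  confines _ (_ ∷ _ ∷ _) = refl

#DDU-DD : ∀ {β} → Dyck β → #DDU (D ∷ D ∷ β) ≡ #DDU β + [nonEmpty] β
#DDU-DD ε            = refl
#DDU-DD (return _ _) = +-comm 1 _

#DDU-return : ∀ {α β} → Dyck α → Dyck β →
              #DDU (U ∷ α ++ D ∷ β) ≡ #DDU α + #DDU β + [nonEmpty] α * [nonEmpty] β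
#DDU-return ε ε            = refl
#DDU-return ε (return _ _) = sym (+-identityʳ _)
#DDU-return {α} {β} (return {a} _ db) dβ with return-∷ʳD {a} db
... | x , α≡x∷ʳD = begin
  #DDU (α ++ D ∷ β)                      ≡⟨ cong (λ w → #DDU (w ++ D ∷ β)) α≡x∷ʳD ⟩
  #DDU ((x ++ D ∷ []) ++ D ∷ β)          ≡⟨ #DDU-∷ʳD-D x β ⟩
  #DDU (x ++ D ∷ []) + #DDU (D ∷ D ∷ β)  ≡⟨ cong₂ _+_ (cong #DDU (sym α≡x∷ʳD)) (#DDU-DD dβ) ⟩
  #DDU α + (#DDU β + [nonEmpty] β)       ≡⟨ reassoc (#DDU α) (#DDU β) ([nonEmpty] β) ⟩
  #DDU α + #DDU β + 1 * [nonEmpty] β     ∎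
  where
  reassoc : ∀ a b c → a + (b + c) ≡ a + b + 1 * c
  reassoc = solve-∀

sumDF+DU+FUU+FUF : (Word → ℕ) → ℕ
sumDF+DU+FUU+FUF f = f (D ∷ F ∷ []) + f (D ∷ U ∷ []) + f (F ∷ U ∷ U ∷ []) + f (F ∷ U ∷ F ∷ [])

#DF+DU+FUU+FUF : Word → ℕ
#DF+DU+FUU+FUF w = sumDF+DU+FUU+FUF (λ X → occ X w)

sumDF+DU+FUU+FUF-+ : ∀ f g k →
  f (D ∷ F ∷ []) ≡ g (D ∷ F ∷ []) + k (D ∷ F ∷ []) →
  f (D ∷ U ∷ []) ≡ g (D ∷ U ∷ []) + k (D ∷ U ∷ []) →
  f (F ∷ U ∷ U ∷ []) ≡ g (F ∷ U ∷ U ∷ []) + k (F ∷ U ∷ U ∷ []) →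
  f (F ∷ U ∷ F ∷ []) ≡ g (F ∷ U ∷ F ∷ []) + k (F ∷ U ∷ F ∷ []) →
  sumDF+DU+FUU+FUF f ≡ sumDF+DU+FUU+FUF g + sumDF+DU+FUU+FUF k
sumDF+DU+FUU+FUF-+ f g k p q r s rewrite p | q | r | s =
  interchange (g (D ∷ F ∷ [])) (g (D ∷ U ∷ [])) (g (F ∷ U ∷ U ∷ [])) (g (F ∷ U ∷ F ∷ []))
              (k (D ∷ F ∷ [])) (k (D ∷ U ∷ [])) (k (F ∷ U ∷ U ∷ [])) (k (F ∷ U ∷ F ∷ []))
  where
  interchange : ∀ a b c d a′ b′ c′ d′ → (a + a′) + (b + b′) + (c + c′) + (d + d′)
                                      ≡ (a + b + c + d) + (a′ + b′ + c′ + d′)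
  interchange = solve-∀

#DF+DU+FUU+FUF-∷ : ∀ s w → #DF+DU+FUU+FUF (s ∷ w)
                   ≡ sumDF+DU+FUU+FUF (λ X → toℕ (isPrefix X (s ∷ w))) + #DF+DU+FUU+FUF w
#DF+DU+FUU+FUF-∷ s w =
  sumDF+DU+FUU+FUF-+ (λ X → occ X (s ∷ w)) (λ X → toℕ (isPrefix X (s ∷ w))) (λ X → occ X w)
                     (occ-∷ _ s w) (occ-∷ _ s w) (occ-∷ _ s w) (occ-∷ _ s w)

#DF+DU+FUU+FUF-∷ʳD : ∀ w → #DF+DU+FUU+FUF (w ++ D ∷ []) ≡ #DF+DU+FUU+FUF w
#DF+DU+FUU+FUF-∷ʳD w =
  cong₂ _+_ (cong₂ _+_ (cong₂ _+_ (occ-∷ʳ (D ∷ []) F (λ ()) w) (occ-∷ʳ (D ∷ []) U (λ ()) w))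
                       (occ-∷ʳ (F ∷ U ∷ []) U (λ ()) w))
            (occ-∷ʳ (F ∷ U ∷ []) F (λ ()) w)

#DF+DU+FUU+FUF-cut : ∀ {w x e} → e ≢ U → w ≡ x ++ e ∷ [] → ∀ y →
                     #DF+DU+FUU+FUF (w ++ y) ≡ #DF+DU+FUU+FUF w + #DF+DU+FUU+FUF (e ∷ y)
#DF+DU+FUU+FUF-cut {x = x} {e} e≢U refl y =
  sumDF+DU+FUU+FUF-+
    (λ X → occ X ((x ++ e ∷ []) ++ y)) (λ X → occ X (x ++ e ∷ [])) (λ X → occ X (e ∷ y))
    (occ-cut D [] F [] x y) (occ-cut D [] U [] x y)
    (occ-cut F (U ∷ []) U (≢-sym e≢U ∷ []) x y) (occ-cut F (U ∷ []) F (≢-sym e≢U ∷ []) x y)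

#DF+DU+FUU+FUF-D∷ : ∀ {w} → StartsNotD w → #DF+DU+FUU+FUF (D ∷ w) ≡ suc (#DF+DU+FUU+FUF w)
#DF+DU+FUU+FUF-D∷ (U , t , _   , refl) = #DF+DU+FUU+FUF-∷ D (U ∷ t)
#DF+DU+FUU+FUF-D∷ (D , _ , D≢D , refl) = ⊥-elim (D≢D refl)
#DF+DU+FUU+FUF-D∷ (F , t , _   , refl) = #DF+DU+FUU+FUF-∷ D (F ∷ t)

#DF+DU+FUU+FUF-turn : ∀ {e w} → e ≢ U → StartsNotD w →
                      #DF+DU+FUU+FUF (e ∷ U ∷ w) ≡ suc (#DF+DU+FUU+FUF w)
#DF+DU+FUU+FUF-turn {U} U≢U _ = ⊥-elim (U≢U refl)
#DF+DU+FUU+FUF-turn {D} {w} _ _ = #DF+DU+FUU+FUF-D∷ (U , w , (λ ()) , refl)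
#DF+DU+FUU+FUF-turn {F} _ (U , t , _   , refl) = #DF+DU+FUU+FUF-∷ F (U ∷ U ∷ t)
#DF+DU+FUU+FUF-turn {F} _ (D , _ , D≢D , refl) = ⊥-elim (D≢D refl)
#DF+DU+FUU+FUF-turn {F} _ (F , t , _   , refl) = #DF+DU+FUU+FUF-∷ F (U ∷ F ∷ t)

#DF+DU+FUU+FUF-F∷ : ∀ {w} → All (_≡ F) w → #DF+DU+FUU+FUF (F ∷ w) ≡ #DF+DU+FUU+FUF w
#DF+DU+FUU+FUF-F∷ []         = refl
#DF+DU+FUU+FUF-F∷ (refl ∷ _) = refl

#DF+DU+FUU+FUF-∷ʳUD : ∀ {w} → All (_≡ F) w → #DF+DU+FUU+FUF (w ++ U ∷ D ∷ []) ≡ #DF+DU+FUU+FUF w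
#DF+DU+FUU+FUF-∷ʳUD []                  = refl
#DF+DU+FUU+FUF-∷ʳUD (refl ∷ [])         = refl
#DF+DU+FUU+FUF-∷ʳUD (refl ∷ refl ∷ Fs) = #DF+DU+FUU+FUF-∷ʳUD (refl ∷ Fs)

#DF+DU+FUU+FUF-D∷φ : ∀ {β} → Dyck β →
                     #DF+DU+FUU+FUF (D ∷ φ β) ≡ [nonEmpty] β + #DF+DU+FUU+FUF (φ β)
#DF+DU+FUU+FUF-D∷φ ε              = refl
#DF+DU+FUU+FUF-D∷φ (return dα dβ) = #DF+DU+FUU+FUF-D∷ (φ-return-startsNotD dα dβ)

#DF+DU+FUU+FUF-φ-nest : ∀ {β γ} → HGe β → HGe γ → h (U ∷ β ++ D ∷ []) ≥ h γ →
  #DF+DU+FUU+FUF (φ (U ∷ (U ∷ β ++ D ∷ γ) ++ D ∷ []))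
  ≡ #DF+DU+FUU+FUF (φ β) + #DF+DU+FUU+FUF (φ γ) + [nonEmpty] β * [nonEmpty] γ
#DF+DU+FUU+FUF-φ-nest {γ = γ} hε hγ γ≤1 = begin
  #DF+DU+FUU+FUF (φ (U ∷ U ∷ D ∷ γ ++ D ∷ []))
    ≡⟨ cong #DF+DU+FUU+FUF (φ-nest ε (HGe⇒Dyck hγ)) ⟩
  #DF+DU+FUU+FUF (φ γ ++ U ∷ D ∷ [])          ≡⟨ #DF+DU+FUU+FUF-∷ʳUD (φ-flat hγ γ≤1) ⟩
  #DF+DU+FUU+FUF (φ γ)                         ≡⟨ +-identityʳ _ ⟨
  #DF+DU+FUU+FUF (φ γ) + 0                     ∎
#DF+DU+FUU+FUF-φ-nest {β} hβ@(hcons _ _ _) hε _ = begin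
  #DF+DU+FUU+FUF (φ (U ∷ (U ∷ β ++ D ∷ []) ++ D ∷ []))
    ≡⟨ cong #DF+DU+FUU+FUF (φ-nest (HGe⇒Dyck hβ) ε) ⟩
  #DF+DU+FUU+FUF (φ β ++ D ∷ [])                   ≡⟨ #DF+DU+FUU+FUF-∷ʳD (φ β) ⟩
  #DF+DU+FUU+FUF (φ β)                              ≡⟨ trans (+-identityʳ _) (+-identityʳ _) ⟨
  #DF+DU+FUU+FUF (φ β) + 0 + 0                      ∎
#DF+DU+FUU+FUF-φ-nest {β} {γ} hβ@(hcons hβ₁ hβ₂ _) hγ@(hcons hγ₁ hγ₂ _) _
  with φ-return-endsNotU (HGe⇒Dyck hγ₁) (HGe⇒Dyck hγ₂)
... | x , e , e≢U , φγ≡x∷ʳe = begin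
  #DF+DU+FUU+FUF (φ (U ∷ (U ∷ β ++ D ∷ γ) ++ D ∷ []))
    ≡⟨ cong #DF+DU+FUU+FUF (φ-nest (HGe⇒Dyck hβ) (HGe⇒Dyck hγ)) ⟩
  #DF+DU+FUU+FUF (φ γ ++ U ∷ φ β ++ D ∷ [])
    ≡⟨ #DF+DU+FUU+FUF-cut e≢U φγ≡x∷ʳe (U ∷ φ β ++ D ∷ []) ⟩
  #DF+DU+FUU+FUF (φ γ) + #DF+DU+FUU+FUF (e ∷ U ∷ φ β ++ D ∷ [])
    ≡⟨ cong (#DF+DU+FUU+FUF (φ γ) +_) (#DF+DU+FUU+FUF-turn e≢U (StartsNotD-++ _ φβ-startsNotD)) ⟩
  #DF+DU+FUU+FUF (φ γ) + suc (#DF+DU+FUU+FUF (φ β ++ D ∷ []))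
    ≡⟨ cong (λ n → #DF+DU+FUU+FUF (φ γ) + suc n) (#DF+DU+FUU+FUF-∷ʳD (φ β)) ⟩
  #DF+DU+FUU+FUF (φ γ) + suc (#DF+DU+FUU+FUF (φ β))
    ≡⟨ rearrange (#DF+DU+FUU+FUF (φ γ)) (#DF+DU+FUU+FUF (φ β)) ⟩
  #DF+DU+FUU+FUF (φ β) + #DF+DU+FUU+FUF (φ γ) + 1 ∎
  where
  φβ-startsNotD : StartsNotD (φ β)
  φβ-startsNotD = φ-return-startsNotD (HGe⇒Dyck hβ₁) (HGe⇒Dyck hβ₂)
  rearrange : ∀ m n → m + suc n ≡ n + m + 1
  rearrange = solve-∀

#DDU≡#DF+DU+FUU+FUF∘φ : ∀ {P} → HGe P → #DDU P ≡ #DF+DU+FUU+FUF (φ P)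
#DDU≡#DF+DU+FUU+FUF∘φ hε = refl
#DDU≡#DF+DU+FUU+FUF∘φ (hcons {[]} {β} hε hβ β≤1) = begin
  #DDU (U ∷ D ∷ β)                   ≡⟨ #DDU-return ε Dβ ⟩
  #DDU β + 0                         ≡⟨ +-identityʳ _ ⟩
  #DDU β                             ≡⟨ #DDU≡#DF+DU+FUU+FUF∘φ hβ ⟩
  #DF+DU+FUU+FUF (φ β)               ≡⟨ #DF+DU+FUU+FUF-F∷ (φ-flat hβ β≤1) ⟨
  #DF+DU+FUU+FUF (F ∷ φ β)           ≡⟨ cong #DF+DU+FUU+FUF (φ-return ε Dβ) ⟨
  #DF+DU+FUU+FUF (φ (U ∷ D ∷ β))     ∎
  where
  Dβ : Dyck β
  Dβ = HGe⇒Dyck hβ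
#DDU≡#DF+DU+FUU+FUF∘φ (hcons {α} {β} hα@(hcons {β′} {γ′} hβ′ hγ′ γ′≤β′) hβ _) = begin
  #DDU (U ∷ α ++ D ∷ β)
    ≡⟨ #DDU-return Dα Dβ ⟩
  #DDU α + #DDU β + 1 * [nonEmpty] β
    ≡⟨ cong₂ (λ a b → a + b + 1 * [nonEmpty] β)
             (#DDU-return Dβ′ Dγ′) (#DDU≡#DF+DU+FUU+FUF∘φ hβ) ⟩
  #DDU β′ + #DDU γ′ + [nonEmpty] β′ * [nonEmpty] γ′ + S (φ β) + 1 * [nonEmpty] β
    ≡⟨ cong₂ (λ b c → b + c + [nonEmpty] β′ * [nonEmpty] γ′ + S (φ β) + 1 * [nonEmpty] β)
             (#DDU≡#DF+DU+FUU+FUF∘φ hβ′) (#DDU≡#DF+DU+FUU+FUF∘φ hγ′) ⟩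
  S (φ β′) + S (φ γ′) + [nonEmpty] β′ * [nonEmpty] γ′ + S (φ β) + 1 * [nonEmpty] β
    ≡⟨ rearrange (S (φ β′) + S (φ γ′) + [nonEmpty] β′ * [nonEmpty] γ′)
                 (S (φ β)) ([nonEmpty] β) ⟩
  (S (φ β′) + S (φ γ′) + [nonEmpty] β′ * [nonEmpty] γ′) + ([nonEmpty] β + S (φ β))
    ≡⟨ cong₂ _+_ (#DF+DU+FUU+FUF-φ-nest hβ′ hγ′ γ′≤β′) (#DF+DU+FUU+FUF-D∷φ Dβ) ⟨
  S (φ (U ∷ α ++ D ∷ [])) + S (D ∷ φ β)
    ≡⟨ #DF+DU+FUU+FUF-cut (λ ()) φUαD≡x∷ʳD (φ β) ⟨
  S (φ (U ∷ α ++ D ∷ []) ++ φ β)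
    ≡⟨ cong S (φ-return Dα Dβ) ⟨
  S (φ (U ∷ α ++ D ∷ β))
    ∎
  where
  S : Word → ℕ
  S = #DF+DU+FUU+FUF
  Dα : Dyck α
  Dα = HGe⇒Dyck hα
  Dβ : Dyck β
  Dβ = HGe⇒Dyck hβ
  Dβ′ : Dyck β′
  Dβ′ = HGe⇒Dyck hβ′
  Dγ′ : Dyck γ′
  Dγ′ = HGe⇒Dyck hγ′
  φUαD≡x∷ʳD : φ (U ∷ α ++ D ∷ []) ≡ (φ γ′ ++ U ∷ φ β′) ++ D ∷ []
  φUαD≡x∷ʳD = trans (φ-nest Dβ′ Dγ′) (sym (++-assoc (φ γ′) (U ∷ φ β′) (D ∷ [])))
  rearrange : ∀ a b c → a + b + 1 * c ≡ a + (c + b)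
  rearrange = solve-∀

theorem10 : (n : ℕ) (P : Word) → InDhGe n P →
    occ (D ∷ D ∷ U ∷ []) P
      ≡ occ (D ∷ F ∷ []) (φ P) + occ (D ∷ U ∷ []) (φ P)
        + occ (F ∷ U ∷ U ∷ []) (φ P) + occ (F ∷ U ∷ F ∷ []) (φ P)
theorem10 _ _ (_ , hP , _) = #DDU≡#DF+DU+FUU+FUF∘φ hP
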